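{- Let $p\in\{3,\dots,9\}$ and $m\ge 1$, and suppose that $\mathrm{forb}(m',F(0,p,1,0))\le c_p m'+1$ for every $m'<m$. Let $A\in\mathrm{Avoid}(m,F(0,p,1,0))$ and suppose that one can delete $s\ge 1$ rows and $t$ columns of $A$ so that the resulting $(m-s)$-rowed matrix is simple, with $c_p s-t\ge 0$. Then $A$ has at most $c_p m+1$ columns.
   Context: A matrix is simple if it is a $(0,1)$-matrix with no repeated columns. $F\prec A$ means some submatrix of $A$ is a row and column permutation of $F$. $\mathrm{Avoid}(m,F)$ is the set of simple $m$-rowed matrices $A$ with $F\not\prec A$; $\mathrm{forb}(m,F)$ is the maximum number of columns of a matrix in $\mathrm{Avoid}(m,F)$. $F(0,p,1,0)$ is the $2\times(p+1)$ matrix with $p$ columns $\binom{1}{0}$ and one column $\binom{0}{1}$. The constants are $c_3=\frac73$, $c_4=\frac{11}4$, $c_5=\frac{15}4$, $c_6=\frac{21}5$, $c_7=\frac{24}5$, $c_8=\frac{27}5$, $c_9=\frac{31}5$. -}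

module Defs where

open import Data.Nat using (ℕ; zero; suc; _+_; _*_; _≤_)
open import Data.Bool using (Bool; true; false)
open import Data.Fin using (Fin)
open import Data.Vec using (Vec)
import Data.Vec as Vec
open import Data.List using (List; length)
import Data.List as List
open import Data.List.Relation.Unary.Unique.Propositional using (Unique)
open import Data.Fin.Subset using (Subset; _∉_; ∣_∣)
open import Data.Product using (Σ; ∃; _×_; _,_)
open import Function.Definitions using (Injective)
open import Relation.Binary.PropositionalEquality using (_≡_)
open import Relation.Nullary using (¬_)

Col : ℕ → Set
Col m = Vec Bool m

Mat : ℕ → Set
Mat m = List (Col m)

ncols : ∀ {m} → Mat m → ℕ
ncols A = length A

entry : ∀ {m} (A : Mat m) → Fin m → Fin (length A) → Bool
entry A r c = Vec.lookup (List.lookup A c) r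

Simple : ∀ {m} → Mat m → Set
Simple A = Unique A

-- A general k × l (0,1)-matrix (configuration), possibly with repeated columns.
Config : ℕ → ℕ → Set
Config k l = Fin k → Fin l → Bool

_≺_ : ∀ {k l m} → Config k l → Mat m → Set
_≺_ {k} {l} {m} F A =
  Σ (Fin k → Fin m) λ σ → Σ (Fin l → Fin (length A)) λ τ →
    Injective _≡_ _≡_ σ × Injective _≡_ _≡_ τ ×
    (∀ i j → entry A (σ i) (τ j) ≡ F i j)

Avoid : ∀ {k l} (m : ℕ) → Config k l → Mat m → Set
Avoid m F A = Simple A × ¬ (F ≺ A)

-- F(0,p,1,0): 2 × (p+1), p columns (1,0)^T and one column (0,1)^T (the last one).
F0p10 : (p : ℕ) → Config 2 (suc p)
F0p10 p Fin.zero j = isNotLast j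
  where
  isNotLast : ∀ {n} → Fin (suc n) → Bool
  isNotLast {zero} Fin.zero = false
  isNotLast {suc n} Fin.zero = true
  isNotLast {suc n} (Fin.suc j) = isNotLast j
F0p10 p (Fin.suc Fin.zero) j = isLast j
  where
  isLast : ∀ {n} → Fin (suc n) → Bool
  isLast {zero} Fin.zero = true
  isLast {suc n} Fin.zero = false
  isLast {suc n} (Fin.suc j) = isLast j

-- c_p = cNum p / cDen p for p = 3..9 (other values are irrelevant dummies)
cNum : ℕ → ℕ
cNum 3 = 7
cNum 4 = 11
cNum 5 = 15
cNum 6 = 21
cNum 7 = 24
cNum 8 = 27
cNum 9 = 31
cNum _ = 0

cDen : ℕ → ℕ
cDen 3 = 3
cDen 4 = 4
cDen 5 = 4
cDen 6 = 5
cDen 7 = 5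
cDen 8 = 5
cDen 9 = 5
cDen _ = 1

-- "x ≤ c_p * m + 1", cleared of denominators: cDen p * x ≤ cNum p * m + cDen p
AtMostCpPlus1 : (p m x : ℕ) → Set
AtMostCpPlus1 p m x = cDen p * x ≤ cNum p * m + cDen p

-- One can delete s rows (set R) and t columns (set C) of A so that the
-- remaining (m - s)-rowed matrix is simple (kept columns pairwise distinct
-- on the kept rows).
CanDeleteToSimple : ∀ {m} → Mat m → (s t : ℕ) → Set
CanDeleteToSimple {m} A s t =
  Σ (Subset m) λ R → Σ (Subset (length A)) λ C →
    ∣ R ∣ ≡ s × ∣ C ∣ ≡ t ×
    (∀ i j → i ∉ C → j ∉ C →
       (∀ r → r ∉ R → entry A r i ≡ entry A r j) → i ≡ j)

{-# OPTIONS --safe #-}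
-- Deleting the rows R and columns C leaves a simple matrix with m - s < m rows
-- which, as a submatrix of A, still avoids F(0,p,1,0).  By hypothesis it has at
-- most c_p (m - s) + 1 columns, and the t deleted columns add at most c_p s.
-- Nothing about c_p beyond c_p s - t ≥ 0 is used, so the range of p is irrelevant.
module Submission where

open import Defs
open import Data.Nat using (ℕ; _≤_; _<_; _*_; _+_)
open import Data.Nat.Properties using (m∸n+n≡m; m<m+n; +-mono-≤; *-distribˡ-+; module ≤-Reasoning)
open import Data.Nat.Tactic.RingSolver using (solve-∀)
open import Data.Fin using (Fin; zero; suc; cast)
open import Data.Fin.Properties using (suc-injective; cast-involutive)
open import Data.Fin.Subset using (Subset; inside; outside; ∁; _∉_; ∣_∣)
open import Data.Fin.Subset.Properties using (∣∁p∣≡n∸∣p∣; ∣p∣≤n)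
open import Data.Vec using (_∷_; here; there)
import Data.Vec as Vec
open import Data.Vec.Properties using (lookup∘tabulate)
open import Data.List using (length; tabulate)
import Data.List as List
open import Data.List.Properties using (length-tabulate; lookup-tabulate)
open import Data.List.Relation.Unary.Unique.Propositional.Properties using (tabulate⁺)
open import Data.Product using (∃; _,_)
open import Data.Empty using (⊥-elim)
open import Function using (_∘_)
open import Function.Definitions using (Injective)
open import Relation.Binary.PropositionalEquality

enum∁ : ∀ {n} (S : Subset n) → Fin ∣ ∁ S ∣ → Fin n
enum∁ (inside  ∷ S) k       = suc (enum∁ S k)
enum∁ (outside ∷ S) zero    = zero
enum∁ (outside ∷ S) (suc k) = suc (enum∁ S k)

enum∁-∉ : ∀ {n} (S : Subset n) k → enum∁ S k ∉ S
enum∁-∉ (inside  ∷ S) k       (there k∈S) = enum∁-∉ S k k∈S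
enum∁-∉ (outside ∷ S) zero    ()
enum∁-∉ (outside ∷ S) (suc k) (there k∈S) = enum∁-∉ S k k∈S

enum∁-injective : ∀ {n} (S : Subset n) → Injective _≡_ _≡_ (enum∁ S)
enum∁-injective (inside  ∷ S) eq = enum∁-injective S (suc-injective eq)
enum∁-injective (outside ∷ S) {zero}  {zero}  eq = refl
enum∁-injective (outside ∷ S) {suc a} {suc b} eq = cong suc (enum∁-injective S (suc-injective eq))

enum∁-surjective : ∀ {n} (S : Subset n) r → r ∉ S → ∃ λ k → enum∁ S k ≡ r
enum∁-surjective (inside  ∷ S) zero    r∉S = ⊥-elim (r∉S here)
enum∁-surjective (inside  ∷ S) (suc r) r∉S with enum∁-surjective S r (r∉S ∘ there)
... | k , refl = k , refl
enum∁-surjective (outside ∷ S) zero    r∉S = zero , refl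
enum∁-surjective (outside ∷ S) (suc r) r∉S with enum∁-surjective S r (r∉S ∘ there)
... | k , refl = suc k , refl

∣∁S∣+∣S∣≡n : ∀ {n} (S : Subset n) → ∣ ∁ S ∣ + ∣ S ∣ ≡ n
∣∁S∣+∣S∣≡n S = trans (cong (_+ ∣ S ∣) (∣∁p∣≡n∸∣p∣ S)) (m∸n+n≡m (∣p∣≤n S))

∣∁S∣<n : ∀ {n} (S : Subset n) → 1 ≤ ∣ S ∣ → ∣ ∁ S ∣ < n
∣∁S∣<n S 1≤∣S∣ = subst (∣ ∁ S ∣ <_) (∣∁S∣+∣S∣≡n S) (m<m+n _ 1≤∣S∣)

cast-injective : ∀ {m n} .(eq : m ≡ n) → Injective _≡_ _≡_ (cast eq)
cast-injective eq {a} {b} e = begin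
  a                           ≡⟨ cast-involutive (sym eq) eq a ⟨
  cast (sym eq) (cast eq a)   ≡⟨ cong (cast (sym eq)) e ⟩
  cast (sym eq) (cast eq b)   ≡⟨ cast-involutive (sym eq) eq b ⟩
  b                           ∎
  where open ≡-Reasoning

lookup-tabulate-cast : ∀ {X : Set} {n} (f : Fin n → X) (c : Fin (length (tabulate f))) →
                       List.lookup (tabulate f) c ≡ f (cast (length-tabulate f) c)
lookup-tabulate-cast f c = trans (cong (List.lookup (tabulate f)) (sym cast-cast-c)) (lookup-tabulate f _)
  where
  cast-cast-c : cast (sym (length-tabulate f)) (cast (length-tabulate f) c) ≡ c
  cast-cast-c = cast-involutive (sym (length-tabulate f)) (length-tabulate f) c

record _⊑_ {k m} (B : Mat k) (A : Mat m) : Set where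
  field
    rows           : Fin k → Fin m
    cols           : Fin (length B) → Fin (length A)
    rows-injective : Injective _≡_ _≡_ rows
    cols-injective : Injective _≡_ _≡_ cols
    entry-≡        : ∀ r c → entry B r c ≡ entry A (rows r) (cols c)

≺-⊑-trans : ∀ {k l m′ m} {F : Config k l} {B : Mat m′} {A : Mat m} → F ≺ B → B ⊑ A → F ≺ A
≺-⊑-trans (σ , τ , σ-inj , τ-inj , B≡F) B⊑A =
  rows ∘ σ , cols ∘ τ , (λ e → σ-inj (rows-injective e)) , (λ e → τ-inj (cols-injective e)) ,
  λ i j → trans (sym (entry-≡ (σ i) (τ j))) (B≡F i j)
  where open _⊑_ B⊑A

restrictRows : ∀ {m} (R : Subset m) → Col m → Col ∣ ∁ R ∣
restrictRows R v = Vec.tabulate (λ r → Vec.lookup v (enum∁ R r))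

module _ {m} (A : Mat m) (R : Subset m) (C : Subset (length A)) where

  reducedColumn : Fin ∣ ∁ C ∣ → Col ∣ ∁ R ∣
  reducedColumn c = restrictRows R (List.lookup A (enum∁ C c))

  deleteRowsCols : Mat ∣ ∁ R ∣
  deleteRowsCols = tabulate reducedColumn

  ncols-deleteRowsCols : ncols deleteRowsCols + ∣ C ∣ ≡ ncols A
  ncols-deleteRowsCols = trans (cong (_+ ∣ C ∣) (length-tabulate reducedColumn)) (∣∁S∣+∣S∣≡n C)

  deleteRowsCols-⊑ : deleteRowsCols ⊑ A
  deleteRowsCols-⊑ = record
    { rows           = enum∁ R
    ; cols           = enum∁ C ∘ cast (length-tabulate reducedColumn)
    ; rows-injective = enum∁-injective R
    ; cols-injective = λ e → cast-injective (length-tabulate reducedColumn) (enum∁-injective C e)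
    ; entry-≡        = λ r c →
        trans (cong (λ v → Vec.lookup v r) (lookup-tabulate-cast reducedColumn c)) (lookup∘tabulate _ r)
    }

  deleteRowsCols-simple :
    (∀ i j → i ∉ C → j ∉ C → (∀ r → r ∉ R → entry A r i ≡ entry A r j) → i ≡ j) →
    Simple deleteRowsCols
  deleteRowsCols-simple distinct = tabulate⁺ reducedColumn-injective
    where
    reducedColumn-injective : Injective _≡_ _≡_ reducedColumn
    reducedColumn-injective {a} {b} e =
      enum∁-injective C (distinct _ _ (enum∁-∉ C a) (enum∁-∉ C b) agree)
      where
      agree : ∀ r → r ∉ R → entry A r (enum∁ C a) ≡ entry A r (enum∁ C b)
      agree r r∉R with enum∁-surjective R r r∉R
      ... | r′ , refl = begin
        Vec.lookup (List.lookup A (enum∁ C a)) (enum∁ R r′) ≡⟨ lookup∘tabulate _ r′ ⟨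
        Vec.lookup (reducedColumn a) r′                     ≡⟨ cong (λ v → Vec.lookup v r′) e ⟩
        Vec.lookup (reducedColumn b) r′                     ≡⟨ lookup∘tabulate _ r′ ⟩
        Vec.lookup (List.lookup A (enum∁ C b)) (enum∁ R r′) ∎
        where open ≡-Reasoning

affine-bound-+ : ∀ c d {x y k s} → d * x ≤ c * k + d → d * y ≤ c * s → d * (x + y) ≤ c * (k + s) + d
affine-bound-+ c d {x} {y} {k} {s} dx≤ck+d dy≤cs = begin
  d * (x + y)        ≡⟨ *-distribˡ-+ d x y ⟩
  d * x + d * y      ≤⟨ +-mono-≤ dx≤ck+d dy≤cs ⟩
  c * k + d + c * s  ≡⟨ rearrange c d k s ⟩
  c * (k + s) + d    ∎
  where
  open ≤-Reasoning
  rearrange : ∀ c d k s → c * k + d + c * s ≡ c * (k + s) + d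
  rearrange = solve-∀

mainTheorem8 : (p : ℕ) → 3 ≤ p → p ≤ 9 → (m : ℕ) → 1 ≤ m →
    (∀ (m' : ℕ) → m' < m → (B : Mat m') → Avoid m' (F0p10 p) B →
       AtMostCpPlus1 p m' (ncols B)) →
    (A : Mat m) → Avoid m (F0p10 p) A →
    (s t : ℕ) → 1 ≤ s → CanDeleteToSimple A s t →
    cDen p * t ≤ cNum p * s →
    AtMostCpPlus1 p m (ncols A)
mainTheorem8 p _ _ m _ forb-bound A (_ , F⊀A) .(∣ R ∣) .(∣ C ∣) 1≤∣R∣ (R , C , refl , refl , distinct) dt≤cs =
  subst₂ (AtMostCpPlus1 p) (∣∁S∣+∣S∣≡n R) (ncols-deleteRowsCols A R C)
    (affine-bound-+ (cNum p) (cDen p) B-bound dt≤cs)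
  where
  B-bound : AtMostCpPlus1 p ∣ ∁ R ∣ (ncols (deleteRowsCols A R C))
  B-bound = forb-bound ∣ ∁ R ∣ (∣∁S∣<n R 1≤∣R∣) (deleteRowsCols A R C)
    (deleteRowsCols-simple A R C distinct , λ F≺B → F⊀A (≺-⊑-trans F≺B (deleteRowsCols-⊑ A R C)))
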